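{- Let $m\ge 1$, let $\mathbf d=(d_1,\dots,d_m)$ be positive integers and let $\boldsymbol\delta=(\delta_1,\dots,\delta_m)$ be positive integers such that $\gcd(\delta_i,d_i)=1$ for every $i$ and $\delta_i d_j\neq \delta_j d_i$ for all $i\neq j$. For $1\le i\le m$ define $\mathbf d_i=(d_{i,1},\dots,d_{i,m})$ by $d_{i,i}=d_i$ and $d_{i,j}=\delta_i d_j-\delta_j d_i$ for $j\neq i$. Then for all real $s$, $$\frac{B^{(m)}_{m-1}(s+\sigma_1(\mathbf d),\mathbf d)}{\pi(\mathbf d)}-\sum_{i=1}^m\frac{B^{(m)}_{m-1}(s\delta_i+\sigma_1(\mathbf d_i),\mathbf d_i)}{\pi(\mathbf d_i)}=0 .$$
   Context: For a vector $\mathbf e=(e_1,\dots,e_m)$ of nonzero numbers, $\pi(\mathbf e)=\prod_i e_i$, $\sigma_r(\mathbf e)=\sum_i e_i^r$, and the Bernoulli polynomials of higher order $B^{(m)}_n(s,\mathbf e)$ are defined by $\dfrac{e^{st}\prod_{i=1}^m e_i}{\prod_{i=1}^m(e^{e_i t}-1)}=\sum_{n\ge0}B^{(m)}_n(s,\mathbf e)\dfrac{t^n}{n!}$. (Equivalently, $\frac{1}{(m-1)!\pi(\mathbf e)}B^{(m)}_{m-1}(s+\sigma_1(\mathbf e),\mathbf e)$ is the polynomial part of the scalar partition function $W(s,\mathbf e)$.)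
   Formalization: The variable s ranges over the rationals instead of the reals. -}

module Defs where

open import Data.Nat as ℕ using (ℕ; zero; suc)
open import Data.Nat.Combinatorics using (_C_)
open import Data.Integer as ℤ using (ℤ)
open import Data.Rational as ℚ using (ℚ; 0ℚ; 1ℚ; _+_; _*_; _-_; -_; _≟_; _÷_; ≢-nonZero)
open import Data.Fin using (Fin; zero; suc; toℕ)
import Data.Fin
open import Data.Vec using (Vec; []; _∷_; lookup; _∷ʳ_)
open import Relation.Nullary using (yes; no)

ΣFin : (n : ℕ) → (Fin n → ℚ) → ℚ
ΣFin zero    f = 0ℚ
ΣFin (suc n) f = f zero + ΣFin n (λ i → f (suc i))

ΠFin : (n : ℕ) → (Fin n → ℚ) → ℚ
ΠFin zero    f = 1ℚ
ΠFin (suc n) f = f zero * ΠFin n (λ i → f (suc i))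

Σ≤ : ℕ → (ℕ → ℚ) → ℚ
Σ≤ zero    f = f 0
Σ≤ (suc n) f = Σ≤ n f + f (suc n)

Σ< : ℕ → (ℕ → ℚ) → ℚ
Σ< zero    f = 0ℚ
Σ< (suc n) f = Σ< n f + f n

_^_ : ℚ → ℕ → ℚ
x ^ zero  = 1ℚ
x ^ suc n = x * (x ^ n)

-- total division (x / 0 := 0); only ever used with nonzero divisors
_/ℚ_ : ℚ → ℚ → ℚ
p /ℚ q with q ≟ 0ℚ
... | yes _  = 0ℚ
... | no q≢0 = _÷_ p q {{≢-nonZero q≢0}}

ℕtoℚ : ℕ → ℚ
ℕtoℚ n = ℤ.+ n ℚ./ 1

ℤtoℚ : ℤ → ℚ
ℤtoℚ z = z ℚ./ 1

-- Exponential generating functions: a sequence a represents Σ a n t^n / n!.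
EGF : Set
EGF = ℕ → ℚ

-- product of EGFs (binomial convolution)
_⊛_ : EGF → EGF → EGF
(a ⊛ b) n = Σ≤ n (λ k → ℕtoℚ (n C k) * (a k * b (n ℕ.∸ k)))

expEGF : ℚ → EGF
expEGF s n = s ^ n

-- Bernoulli numbers: the EGF coefficients of t/(e^t - 1), i.e. the inverse
-- of (e^t - 1)/t = Σ t^n/(n+1)!, whose EGF coefficients are 1/(n+1).
private
  nextB : (n : ℕ) → Vec ℚ n → ℚ
  nextB zero    _  = 1ℚ
  nextB (suc n) bs = - Σ< (suc n) (λ k → ℕtoℚ (suc n C k) * (get k bs * (ℤ.+ 1 ℚ./ suc (suc n ℕ.∸ k))))
    where
    get : ∀ {m} → ℕ → Vec ℚ m → ℚ
    get _       []       = 0ℚ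
    get zero    (x ∷ _)  = x
    get (suc k) (_ ∷ xs) = get k xs

  bernVec : (n : ℕ) → Vec ℚ n
  bernVec zero    = []
  bernVec (suc n) = bernVec n ∷ʳ nextB n (bernVec n)

bernoulli : ℕ → ℚ
bernoulli n = lookup (bernVec (suc n)) (Data.Fin.fromℕ n)

-- e t / (e^{e t} - 1) = Σ B_n e^n t^n / n!
bernEGF : ℚ → EGF
bernEGF e n = (e ^ n) * bernoulli n

-- Higher-order Bernoulli polynomials:
-- t^m e^{s t} Π_i e_i / Π_i (e^{e_i t} - 1) = e^{st} Π_i (e_i t/(e^{e_i t}-1))
--   = Σ_n B^{(m)}_n(s, e) t^n / n!
higherBernoulliEGF : (m : ℕ) → ℚ → (Fin m → ℚ) → EGF
higherBernoulliEGF zero    s e = expEGF s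
higherBernoulliEGF (suc m) s e = bernEGF (e zero) ⊛ higherBernoulliEGF m s (λ i → e (suc i))

B[_]_ : (m : ℕ) → ℕ → ℚ → (Fin m → ℚ) → ℚ
(B[ m ] n) s e = higherBernoulliEGF m s e n

πv : (m : ℕ) → (Fin m → ℚ) → ℚ
πv m e = ΠFin m e

σ₁ : (m : ℕ) → (Fin m → ℚ) → ℚ
σ₁ m e = ΣFin m e

dvec : (m : ℕ) → (d δ : Fin m → ℕ) → Fin m → Fin m → ℚ
dvec m d δ i j with toℕ i ℕ.≟ toℕ j
... | yes _ = ℕtoℚ (d i)
... | no  _ = ℤtoℚ ((ℤ.+ (δ i ℕ.* d j)) ℤ.- (ℤ.+ (δ j ℕ.* d i)))

{-# OPTIONS --safe #-}
module Submission where

-- Put ρ i = d i / δ i and e z = (z, d 1 - z δ 1, …, d m - z δ m). Then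
-- N z = B^(m+1)_(m-1)(s + σ₁(e z), e z) is a polynomial of degree ≤ m - 1 in z, so its m-th
-- divided difference at the distinct nodes 0, ρ 1, …, ρ m vanishes. A parameter equal to 0 can be
-- dropped from B^(m+1), since its factor t / (e^(0 t) - 1) is 1; hence N 0 is the first term of
-- the identity. At z = ρ i the parameter d i - z δ i vanishes and the remaining ones are, up to
-- order, those of d_i divided by δ i, so by symmetry and homogeneity
-- δ i^(m-1) N (ρ i) = B^(m)_(m-1)(s δ i + σ₁(d_i), d_i). Multiplied by Π δ i, the divided
-- difference becomes the left-hand side.

open import Defs
import Data.Nat
open import Data.Nat using (ℕ)
open import Data.Nat.Coprimality using (Coprime)
open import Data.Fin using (Fin)
open import Data.Rational using (ℚ; 0ℚ; _+_; _-_; _*_)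
open import Relation.Binary.PropositionalEquality using (_≡_; _≢_)

open import Level using (0ℓ)
open import Algebra.Bundles using (CommutativeMonoid)
import Algebra.Properties.CommutativeSemigroup as CommSemigroupProperties
open import Data.Nat as ℕ using (zero; suc; _∸_; _≤_; z≤n; s≤s)
import Data.Nat.Properties as ℕ
open import Data.Nat.Combinatorics using (_C_; nCk+nC[k+1]≡[n+1]C[k+1]; k>n⇒nCk≡0)
open import Data.Nat.Coprimality using (1-coprimeTo) renaming (sym to Coprime-sym)
import Data.Integer as ℤ
import Data.Integer.Properties as ℤ
open import Data.Rational as ℚ using (1ℚ; -_; 1/_; mkℚ; ≢-nonZero; _≟_)
open import Data.Rational.Properties
  using (+-*-commutativeRing; +-*-ring; +-0-group; +-0-commutativeMonoid; *-1-commutativeMonoid;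
         +-assoc; +-comm; +-identityˡ; +-identityʳ; +-inverseʳ; *-comm; *-assoc; *-identityˡ; *-identityʳ;
         *-zeroˡ; *-zeroʳ; *-distribˡ-+; *-distribʳ-+; *-inverseˡ; *-inverseʳ; neg-distrib-+; neg-distribʳ-*;
         ↥p/↧p≡p; /-cong)
open import Data.Fin as Fin using (zero; suc; toℕ; punchIn)
open import Data.Fin.Properties using (punchInᵢ≢i; punchIn-injective; suc-injective; toℕ-injective)
open import Data.Vec.Functional using (_∷_)
open import Data.Product using (Σ-syntax; _×_; _,_)
open import Data.Empty using (⊥-elim)
open import Function using (_∘_)
open import Function.Definitions using (Injective)
open import Relation.Nullary using (Dec; yes; no)
open import Relation.Nullary.Decidable using (dec⇒maybe)
open import Relation.Binary.PropositionalEquality using (_≗_; refl; sym; trans; cong; cong₂; module ≡-Reasoning)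
open import Algebra.Properties.Group +-0-group using () renaming (x∙y⁻¹≈ε⇒x≈y to x-y≡0⇒x≡y)
open import Algebra.Properties.Ring +-*-ring using (-1*x≈-x)
open import Tactic.RingSolver using (solve-∀)
open import Tactic.RingSolver.Core.AlmostCommutativeRing using (AlmostCommutativeRing; fromCommutativeRing)

open ≡-Reasoning
open CommSemigroupProperties (CommutativeMonoid.commutativeSemigroup +-0-commutativeMonoid)
  using () renaming (interchange to +-interchange; x∙yz≈y∙xz to x+yz≡y+xz)
open CommSemigroupProperties (CommutativeMonoid.commutativeSemigroup *-1-commutativeMonoid)
  using () renaming (interchange to *-interchange; x∙yz≈y∙xz to x*yz≡y*xz)

ℚ-ring : AlmostCommutativeRing 0ℓ 0ℓ
ℚ-ring = fromCommutativeRing +-*-commutativeRing (λ p → dec⇒maybe (0ℚ ≟ p))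

-- Total inverse, with 0ℚ ⁻¹ = 0ℚ.
_⁻¹ : ℚ → ℚ
p ⁻¹ with p ≟ 0ℚ
... | yes _  = 0ℚ
... | no p≢0 = (1/ p) {{≢-nonZero p≢0}}

infix 8 _⁻¹

⁻¹-inverseʳ : ∀ {p} → p ≢ 0ℚ → p * p ⁻¹ ≡ 1ℚ
⁻¹-inverseʳ {p} p≢0 with p ≟ 0ℚ
... | yes p≡0 = ⊥-elim (p≢0 p≡0)
... | no p≢0′ = *-inverseʳ p {{≢-nonZero p≢0′}}

/ℚ≡*⁻¹ : ∀ p q → p /ℚ q ≡ p * q ⁻¹
/ℚ≡*⁻¹ p q with q ≟ 0ℚ
... | yes _ = sym (*-zeroʳ p)
... | no _  = refl

1≢0 : 1ℚ ≢ 0ℚ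
1≢0 ()

x*y≡0⇒x≡0 : ∀ {x y} → y ≢ 0ℚ → x * y ≡ 0ℚ → x ≡ 0ℚ
x*y≡0⇒x≡0 {x} {y} y≢0 xy≡0 = begin
  x                ≡⟨ sym (trans (cong (x *_) (⁻¹-inverseʳ y≢0)) (*-identityʳ x)) ⟩
  x * (y * y ⁻¹)   ≡⟨ sym (*-assoc x y (y ⁻¹)) ⟩
  (x * y) * y ⁻¹   ≡⟨ cong (_* y ⁻¹) xy≡0 ⟩
  0ℚ * y ⁻¹        ≡⟨ *-zeroˡ (y ⁻¹) ⟩
  0ℚ               ∎

x≢0∧y≢0⇒x*y≢0 : ∀ {x y} → x ≢ 0ℚ → y ≢ 0ℚ → x * y ≢ 0ℚ
x≢0∧y≢0⇒x*y≢0 x≢0 y≢0 xy≡0 = x≢0 (x*y≡0⇒x≡0 y≢0 xy≡0)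

*-cancelˡ-≡0 : ∀ {c x} → c ≢ 0ℚ → c * x ≡ 0ℚ → x ≡ 0ℚ
*-cancelˡ-≡0 {c} {x} c≢0 cx≡0 = x*y≡0⇒x≡0 c≢0 (trans (*-comm x c) cx≡0)

⁻¹-unique : ∀ p q → p * q ≡ 1ℚ → p ⁻¹ ≡ q
⁻¹-unique p q pq≡1 with p ≟ 0ℚ
... | yes p≡0 = ⊥-elim (1≢0 (trans (sym pq≡1) (trans (cong (_* q) p≡0) (*-zeroˡ q))))
... | no p≢0 = begin
  1/p              ≡⟨ sym (*-identityʳ 1/p) ⟩
  1/p * 1ℚ         ≡⟨ cong (1/p *_) (sym pq≡1) ⟩
  1/p * (p * q)    ≡⟨ sym (*-assoc 1/p p q) ⟩
  (1/p * p) * q    ≡⟨ cong (_* q) (*-inverseˡ p {{≢-nonZero p≢0}}) ⟩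
  1ℚ * q           ≡⟨ *-identityˡ q ⟩
  q                ∎
  where 1/p = (1/ p) {{≢-nonZero p≢0}}

⁻¹-distrib-* : ∀ p q → (p * q) ⁻¹ ≡ p ⁻¹ * q ⁻¹
⁻¹-distrib-* p q = by-cases (p ≟ 0ℚ) (q ≟ 0ℚ)
  where
  by-cases : Dec (p ≡ 0ℚ) → Dec (q ≡ 0ℚ) → (p * q) ⁻¹ ≡ p ⁻¹ * q ⁻¹
  by-cases (yes refl) _ = trans (cong _⁻¹ (*-zeroˡ q)) (sym (*-zeroˡ (q ⁻¹)))
  by-cases (no _) (yes refl) = trans (cong _⁻¹ (*-zeroʳ p)) (sym (*-zeroʳ (p ⁻¹)))
  by-cases (no p≢0) (no q≢0) = ⁻¹-unique (p * q) (p ⁻¹ * q ⁻¹) (begin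
    (p * q) * (p ⁻¹ * q ⁻¹)   ≡⟨ *-interchange p q (p ⁻¹) (q ⁻¹) ⟩
    (p * p ⁻¹) * (q * q ⁻¹)   ≡⟨ cong₂ _*_ (⁻¹-inverseʳ p≢0) (⁻¹-inverseʳ q≢0) ⟩
    1ℚ                        ∎)

⁻¹-neg : ∀ p → (- p) ⁻¹ ≡ - (p ⁻¹)
⁻¹-neg p = begin
  (- p) ⁻¹               ≡⟨ cong _⁻¹ (neg-as-* p) ⟩
  (- 1ℚ * p) ⁻¹          ≡⟨ ⁻¹-distrib-* (- 1ℚ) p ⟩
  (- 1ℚ) ⁻¹ * p ⁻¹       ≡⟨⟩
  - 1ℚ * p ⁻¹            ≡⟨ sym (neg-as-* (p ⁻¹)) ⟩
  - (p ⁻¹)               ∎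
  where
  neg-as-* : ∀ a → - a ≡ - 1ℚ * a
  neg-as-* = solve-∀ ℚ-ring

*-cancelˡ-⁻¹ : ∀ {c} x y → c ≢ 0ℚ → (c * x) * (c * y) ⁻¹ ≡ x * y ⁻¹
*-cancelˡ-⁻¹ {c} x y c≢0 = begin
  (c * x) * (c * y) ⁻¹        ≡⟨ cong ((c * x) *_) (⁻¹-distrib-* c y) ⟩
  (c * x) * (c ⁻¹ * y ⁻¹)     ≡⟨ *-interchange c x (c ⁻¹) (y ⁻¹) ⟩
  (c * c ⁻¹) * (x * y ⁻¹)     ≡⟨ cong (_* (x * y ⁻¹)) (⁻¹-inverseʳ c≢0) ⟩
  1ℚ * (x * y ⁻¹)             ≡⟨ *-identityˡ (x * y ⁻¹) ⟩
  x * y ⁻¹                    ∎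

x-y≢0 : ∀ {x y} → x ≢ y → x - y ≢ 0ℚ
x-y≢0 {x} {y} x≢y = x≢y ∘ x-y≡0⇒x≡y x y

[x-y]*[y-x]⁻¹≡-1 : ∀ {x y} → x ≢ y → (x - y) * (y - x) ⁻¹ ≡ - 1ℚ
[x-y]*[y-x]⁻¹≡-1 {x} {y} x≢y = begin
  (x - y) * (y - x) ⁻¹          ≡⟨ cong (λ t → (x - y) * t ⁻¹) (swap-sub x y) ⟩
  (x - y) * (- (x - y)) ⁻¹      ≡⟨ cong ((x - y) *_) (⁻¹-neg (x - y)) ⟩
  (x - y) * - ((x - y) ⁻¹)      ≡⟨ sym (neg-distribʳ-* (x - y) _) ⟩
  - ((x - y) * (x - y) ⁻¹)      ≡⟨ cong -_ (⁻¹-inverseʳ (x-y≢0 x≢y)) ⟩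
  - 1ℚ                          ∎
  where
  swap-sub : ∀ a b → b - a ≡ - (a - b)
  swap-sub = solve-∀ ℚ-ring

ΣFin-cong : ∀ k {f g : Fin k → ℚ} → (∀ i → f i ≡ g i) → ΣFin k f ≡ ΣFin k g
ΣFin-cong zero    f≗g = refl
ΣFin-cong (suc k) f≗g = cong₂ _+_ (f≗g zero) (ΣFin-cong k (f≗g ∘ suc))

ΣFin-+ : ∀ k (f g : Fin k → ℚ) → ΣFin k (λ i → f i + g i) ≡ ΣFin k f + ΣFin k g
ΣFin-+ zero    f g = refl
ΣFin-+ (suc k) f g = trans (cong (f zero + g zero +_) (ΣFin-+ k (f ∘ suc) (g ∘ suc)))
                           (+-interchange (f zero) (g zero) _ _)

ΣFin-*ˡ : ∀ k c (f : Fin k → ℚ) → ΣFin k (λ i → c * f i) ≡ c * ΣFin k f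
ΣFin-*ˡ zero    c f = sym (*-zeroʳ c)
ΣFin-*ˡ (suc k) c f = trans (cong (c * f zero +_) (ΣFin-*ˡ k c (f ∘ suc)))
                            (sym (*-distribˡ-+ c (f zero) _))

ΣFin-neg : ∀ k (f : Fin k → ℚ) → ΣFin k (λ i → - f i) ≡ - ΣFin k f
ΣFin-neg zero    f = refl
ΣFin-neg (suc k) f = trans (cong (- f zero +_) (ΣFin-neg k (f ∘ suc)))
                           (sym (neg-distrib-+ (f zero) _))

ΣFin-punchIn : ∀ k (f : Fin (suc k) → ℚ) i → ΣFin (suc k) f ≡ f i + ΣFin k (f ∘ punchIn i)
ΣFin-punchIn k       f zero    = refl
ΣFin-punchIn (suc k) f (suc i) = trans (cong (f zero +_) (ΣFin-punchIn k (f ∘ suc) i))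
                                       (x+yz≡y+xz (f zero) (f (suc i)) _)

ΠFin-cong : ∀ k {f g : Fin k → ℚ} → (∀ i → f i ≡ g i) → ΠFin k f ≡ ΠFin k g
ΠFin-cong zero    f≗g = refl
ΠFin-cong (suc k) f≗g = cong₂ _*_ (f≗g zero) (ΠFin-cong k (f≗g ∘ suc))

ΠFin-* : ∀ k (f g : Fin k → ℚ) → ΠFin k (λ i → f i * g i) ≡ ΠFin k f * ΠFin k g
ΠFin-* zero    f g = refl
ΠFin-* (suc k) f g = trans (cong (f zero * g zero *_) (ΠFin-* k (f ∘ suc) (g ∘ suc)))
                           (*-interchange (f zero) (g zero) _ _)

ΠFin-*ˡ : ∀ k c (f : Fin k → ℚ) → ΠFin k (λ i → c * f i) ≡ (c ^ k) * ΠFin k f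
ΠFin-*ˡ zero    c f = refl
ΠFin-*ˡ (suc k) c f = trans (cong (c * f zero *_) (ΠFin-*ˡ k c (f ∘ suc)))
                            (*-interchange c (f zero) (c ^ k) _)

ΠFin-punchIn : ∀ k (f : Fin (suc k) → ℚ) i → ΠFin (suc k) f ≡ f i * ΠFin k (f ∘ punchIn i)
ΠFin-punchIn k       f zero    = refl
ΠFin-punchIn (suc k) f (suc i) = trans (cong (f zero *_) (ΠFin-punchIn k (f ∘ suc) i))
                                       (x*yz≡y*xz (f zero) (f (suc i)) _)

ΠFin-≢0 : ∀ k (f : Fin k → ℚ) → (∀ i → f i ≢ 0ℚ) → ΠFin k f ≢ 0ℚ
ΠFin-≢0 zero    f f≢0 = 1≢0
ΠFin-≢0 (suc k) f f≢0 = x≢0∧y≢0⇒x*y≢0 (f≢0 zero) (ΠFin-≢0 k (f ∘ suc) (f≢0 ∘ suc))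

^-≢0 : ∀ k {c} → c ≢ 0ℚ → c ^ k ≢ 0ℚ
^-≢0 zero    c≢0 = 1≢0
^-≢0 (suc k) c≢0 = x≢0∧y≢0⇒x*y≢0 c≢0 (^-≢0 k c≢0)

^-distrib-* : ∀ k a b → (a * b) ^ k ≡ (a ^ k) * (b ^ k)
^-distrib-* zero    a b = refl
^-distrib-* (suc k) a b = trans (cong ((a * b) *_) (^-distrib-* k a b)) (*-interchange a b (a ^ k) (b ^ k))

ℤtoℚ≡mkℚ : ∀ z → ℤtoℚ z ≡ mkℚ z 0 (Coprime-sym (1-coprimeTo ℤ.∣ z ∣))
ℤtoℚ≡mkℚ z = ↥p/↧p≡p (mkℚ z 0 (Coprime-sym (1-coprimeTo ℤ.∣ z ∣)))

ℤtoℚ-+ : ∀ a b → ℤtoℚ (a ℤ.+ b) ≡ ℤtoℚ a + ℤtoℚ b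
ℤtoℚ-+ a b = sym (begin
  ℤtoℚ a + ℤtoℚ b                         ≡⟨ cong₂ _+_ (ℤtoℚ≡mkℚ a) (ℤtoℚ≡mkℚ b) ⟩
  (a ℤ.* ℤ.+ 1 ℤ.+ b ℤ.* ℤ.+ 1) ℚ./ 1
    ≡⟨ /-cong {p₂ = a ℤ.+ b} (cong₂ ℤ._+_ (ℤ.*-identityʳ a) (ℤ.*-identityʳ b)) refl ⟩
  ℤtoℚ (a ℤ.+ b)                          ∎)

ℤtoℚ-* : ∀ a b → ℤtoℚ (a ℤ.* b) ≡ ℤtoℚ a * ℤtoℚ b
ℤtoℚ-* a b = sym (cong₂ _*_ (ℤtoℚ≡mkℚ a) (ℤtoℚ≡mkℚ b))

ℤtoℚ-neg : ∀ a → ℤtoℚ (ℤ.- a) ≡ - ℤtoℚ a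
ℤtoℚ-neg a = trans (ℤtoℚ≡mkℚ (ℤ.- a)) (trans (mkℚ-neg a) (cong -_ (sym (ℤtoℚ≡mkℚ a))))
  where
  mkℚ-neg : ∀ a → mkℚ (ℤ.- a) 0 (Coprime-sym (1-coprimeTo ℤ.∣ ℤ.- a ∣))
                  ≡ - mkℚ a 0 (Coprime-sym (1-coprimeTo ℤ.∣ a ∣))
  mkℚ-neg (ℤ.+ zero)  = refl
  mkℚ-neg (ℤ.+ suc n) = refl
  mkℚ-neg ℤ.-[1+ n ]  = refl

ℤtoℚ-sub : ∀ a b → ℤtoℚ (a ℤ.- b) ≡ ℤtoℚ a - ℤtoℚ b
ℤtoℚ-sub a b = trans (ℤtoℚ-+ a (ℤ.- b)) (cong (ℤtoℚ a +_) (ℤtoℚ-neg b))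

ℕtoℚ-+ : ∀ m n → ℕtoℚ (m ℕ.+ n) ≡ ℕtoℚ m + ℕtoℚ n
ℕtoℚ-+ m n = trans (cong ℤtoℚ (ℤ.pos-+ m n)) (ℤtoℚ-+ (ℤ.+ m) (ℤ.+ n))

ℕtoℚ-* : ∀ m n → ℕtoℚ (m ℕ.* n) ≡ ℕtoℚ m * ℕtoℚ n
ℕtoℚ-* m n = trans (cong ℤtoℚ (ℤ.pos-* m n)) (ℤtoℚ-* (ℤ.+ m) (ℤ.+ n))

ℕtoℚ-injective : ∀ {m n} → ℕtoℚ m ≡ ℕtoℚ n → m ≡ n
ℕtoℚ-injective {m} {n} eq =
  ℤ.+-injective (cong ℚ.↥_ (trans (sym (ℤtoℚ≡mkℚ (ℤ.+ m))) (trans eq (ℤtoℚ≡mkℚ (ℤ.+ n)))))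

ℕtoℚ-≢0 : ∀ {n} → 1 ℕ.≤ n → ℕtoℚ n ≢ 0ℚ
ℕtoℚ-≢0 {suc n} _ eq with ℕtoℚ-injective {suc n} {0} eq
... | ()

-- Polynomial maps of degree ≤ k, described without coefficients by repeated division by z - a.
Deg≤ : ℕ → (ℚ → ℚ) → Set
Deg≤ zero    f = ∀ z w → f z ≡ f w
Deg≤ (suc k) f = ∀ a → Σ[ g ∈ (ℚ → ℚ) ] Deg≤ k g × (∀ z → f z ≡ f a + (z - a) * g z)

Deg≤-cong : ∀ k {f g : ℚ → ℚ} → (∀ z → f z ≡ g z) → Deg≤ k f → Deg≤ k g
Deg≤-cong zero    f≗g df z w = trans (sym (f≗g z)) (trans (df z w) (f≗g w))
Deg≤-cong (suc k) f≗g df a with df a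
... | h , dh , f≡ = h , dh , λ z → trans (sym (f≗g z)) (trans (f≡ z) (cong (λ t → t + (z - a) * h z) (f≗g a)))

Deg≤-const : ∀ k c → Deg≤ k (λ _ → c)
Deg≤-const zero    c z w = refl
Deg≤-const (suc k) c a   = (λ _ → 0ℚ) , Deg≤-const k 0ℚ , λ z → sym (x+y*0≡x c (z - a))
  where
  x+y*0≡x : ∀ x y → x + y * 0ℚ ≡ x
  x+y*0≡x = solve-∀ ℚ-ring

Deg≤-suc : ∀ k {f} → Deg≤ k f → Deg≤ (suc k) f
Deg≤-suc zero    {f} df = Deg≤-cong 1 (df 0ℚ) (Deg≤-const 1 (f 0ℚ))
Deg≤-suc (suc k) df a with df a
... | g , dg , f≡ = g , Deg≤-suc k dg , f≡

Deg≤-mono : ∀ {k l f} → k ≤ l → Deg≤ k f → Deg≤ l f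
Deg≤-mono {zero}  {zero}  z≤n       df = df
Deg≤-mono {zero}  {suc l} z≤n       df = Deg≤-suc l (Deg≤-mono z≤n df)
Deg≤-mono {suc k} {suc l} (s≤s k≤l) df a with df a
... | g , dg , f≡ = g , Deg≤-mono k≤l dg , f≡

Deg≤-+ : ∀ k {f g : ℚ → ℚ} → Deg≤ k f → Deg≤ k g → Deg≤ k (λ z → f z + g z)
Deg≤-+ zero    df dg z w = cong₂ _+_ (df z w) (dg z w)
Deg≤-+ (suc k) {f} {g} df dg a with df a | dg a
... | F , dF , f≡ | G , dG , g≡ = (λ z → F z + G z) , Deg≤-+ k dF dG , λ z → begin
  f z + g z                                          ≡⟨ cong₂ _+_ (f≡ z) (g≡ z) ⟩
  (f a + (z - a) * F z) + (g a + (z - a) * G z)      ≡⟨ regroup (f a) (g a) (F z) (G z) (z - a) ⟩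
  (f a + g a) + (z - a) * (F z + G z)                ∎
  where
  regroup : ∀ x y u v d → (x + d * u) + (y + d * v) ≡ (x + y) + d * (u + v)
  regroup = solve-∀ ℚ-ring

Deg≤-*ˡ : ∀ k c {f : ℚ → ℚ} → Deg≤ k f → Deg≤ k (λ z → c * f z)
Deg≤-*ˡ zero    c df z w = cong (c *_) (df z w)
Deg≤-*ˡ (suc k) c {f} df a with df a
... | F , dF , f≡ = (λ z → c * F z) , Deg≤-*ˡ k c dF , λ z →
  trans (cong (c *_) (f≡ z)) (distrib c (f a) (F z) (z - a))
  where
  distrib : ∀ c x u d → c * (x + d * u) ≡ c * x + d * (c * u)
  distrib = solve-∀ ℚ-ring

Deg≤-id : Deg≤ 1 (λ z → z)
Deg≤-id a = (λ _ → 1ℚ) , Deg≤-const 0 1ℚ , λ z → z≡a+[z-a]*1 z a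
  where
  z≡a+[z-a]*1 : ∀ z a → z ≡ a + (z - a) * 1ℚ
  z≡a+[z-a]*1 = solve-∀ ℚ-ring

Deg≤-* : ∀ k l {f g : ℚ → ℚ} → Deg≤ k f → Deg≤ l g → Deg≤ (k ℕ.+ l) (λ z → f z * g z)
Deg≤-* zero    l {f} {g} df dg = Deg≤-cong l (λ z → cong (_* g z) (df 0ℚ z)) (Deg≤-*ˡ l (f 0ℚ) dg)
Deg≤-* (suc k) zero {f} {g} df dg a with df a
... | F , dF , f≡ = (λ z → F z * g z) , Deg≤-* k zero dF dg , λ z → begin
  f z * g z                         ≡⟨ cong₂ _*_ (f≡ z) (dg z a) ⟩
  (f a + (z - a) * F z) * g a       ≡⟨ expand (f a) (F z) (g a) (z - a) ⟩
  f a * g a + (z - a) * (F z * g a) ≡⟨ cong (λ t → f a * g a + (z - a) * (F z * t)) (dg a z) ⟩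
  f a * g a + (z - a) * (F z * g z) ∎
  where
  expand : ∀ x u y d → (x + d * u) * y ≡ x * y + d * (u * y)
  expand = solve-∀ ℚ-ring
Deg≤-* (suc k) (suc l) {f} {g} df dg a with df a | dg a
... | F , dF , f≡ | G , dG , g≡ =
  (λ z → F z * g z + f a * G z) ,
  Deg≤-+ (k ℕ.+ suc l) (Deg≤-* k (suc l) dF dg) (Deg≤-mono (ℕ.m≤n+m (suc l) k) (Deg≤-suc l (Deg≤-*ˡ l (f a) dG))) ,
  λ z → begin
  f z * g z                                          ≡⟨ cong (_* g z) (f≡ z) ⟩
  (f a + (z - a) * F z) * g z                        ≡⟨ *-distribʳ-+ (g z) (f a) _ ⟩
  f a * g z + (z - a) * F z * g z                    ≡⟨ cong (λ t → f a * t + (z - a) * F z * g z) (g≡ z) ⟩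
  f a * (g a + (z - a) * G z) + (z - a) * F z * g z  ≡⟨ expand (f a) (F z) (g a) (G z) (g z) (z - a) ⟩
  f a * g a + (z - a) * (F z * g z + f a * G z)      ∎
  where
  expand : ∀ x u y v w d → x * (y + d * v) + d * u * w ≡ x * y + d * (u * w + x * v)
  expand = solve-∀ ℚ-ring

Deg≤-^ : ∀ k {f : ℚ → ℚ} → Deg≤ 1 f → Deg≤ k (λ z → f z ^ k)
Deg≤-^ zero    df = Deg≤-const 0 1ℚ
Deg≤-^ (suc k) df = Deg≤-* 1 k df (Deg≤-^ k df)

Deg≤-ΣFin : ∀ k n (f : ℚ → Fin n → ℚ) → (∀ i → Deg≤ k (λ z → f z i)) → Deg≤ k (λ z → ΣFin n (f z))
Deg≤-ΣFin k zero    f df = Deg≤-const k 0ℚ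
Deg≤-ΣFin k (suc n) f df = Deg≤-+ k (df zero) (Deg≤-ΣFin k n (λ z → f z ∘ suc) (df ∘ suc))

Deg≤-Σ≤ : ∀ k n (f : ℚ → ℕ → ℚ) → (∀ i → i ≤ n → Deg≤ k (λ z → f z i)) →
          Deg≤ k (λ z → Σ≤ n (f z))
Deg≤-Σ≤ k zero    f df = df 0 z≤n
Deg≤-Σ≤ k (suc n) f df =
  Deg≤-+ k (Deg≤-Σ≤ k n f (λ i i≤n → df i (ℕ.m≤n⇒m≤1+n i≤n))) (df (suc n) ℕ.≤-refl)

Deg≤-affine : ∀ a b → Deg≤ 1 (λ z → a + b * z)
Deg≤-affine a b = Deg≤-+ 1 (Deg≤-const 1 a) (Deg≤-*ˡ 1 b Deg≤-id)

-- divDiff k f r is the divided difference f[r 0, …, r k] up to the sign (-1)^k: its weights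
-- are 1 / Π_{j ≠ i} (r j - r i) rather than 1 / Π_{j ≠ i} (r i - r j).
nodeWeight : ∀ k → (Fin (suc k) → ℚ) → Fin (suc k) → ℚ
nodeWeight k r i = ΠFin k (λ j → r (punchIn i j) - r i) ⁻¹

divDiff : ∀ k → (ℚ → ℚ) → (Fin (suc k) → ℚ) → ℚ
divDiff k f r = ΣFin (suc k) (λ i → f (r i) * nodeWeight k r i)

divDiff-cong : ∀ k {f g : ℚ → ℚ} r → (∀ z → f z ≡ g z) → divDiff k f r ≡ divDiff k g r
divDiff-cong k r f≗g = ΣFin-cong (suc k) (λ i → cong (_* nodeWeight k r i) (f≗g (r i)))

divDiff-+ : ∀ k (f g : ℚ → ℚ) r → divDiff k (λ z → f z + g z) r ≡ divDiff k f r + divDiff k g r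
divDiff-+ k f g r = trans (ΣFin-cong (suc k) (λ i → *-distribʳ-+ (w i) (f (r i)) (g (r i))))
                          (ΣFin-+ (suc k) (λ i → f (r i) * w i) (λ i → g (r i) * w i))
  where
  w = nodeWeight k r

divDiff-*ˡ : ∀ k c (f : ℚ → ℚ) r → divDiff k (λ z → c * f z) r ≡ c * divDiff k f r
divDiff-*ˡ k c f r = trans (ΣFin-cong (suc k) (λ i → *-assoc c (f (r i)) (w i))) (ΣFin-*ˡ (suc k) c (λ i → f (r i) * w i))
  where
  w = nodeWeight k r

-- r (suc zero) ∷ r ∘ punchIn (suc zero) is r with its first two nodes exchanged.
divDiff-swap : ∀ k f (r : Fin (suc (suc k)) → ℚ) →
               divDiff (suc k) f (r (suc zero) ∷ r ∘ punchIn (suc zero)) ≡ divDiff (suc k) f r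
divDiff-swap k f r = begin
  term r′ zero + (term r′ (suc zero) + ΣFin k (λ i → term r′ (suc (suc i))))
    ≡⟨ cong (λ t → term r (suc zero) + (term r zero + t)) (ΣFin-cong k later-node) ⟩
  term r (suc zero) + (term r zero + ΣFin k (λ i → term r (suc (suc i))))
    ≡⟨ x+yz≡y+xz (term r (suc zero)) (term r zero) _ ⟩
  term r zero + (term r (suc zero) + ΣFin k (λ i → term r (suc (suc i)))) ∎
  where
  r′ = r (suc zero) ∷ r ∘ punchIn (suc zero)
  term : (Fin (suc (suc k)) → ℚ) → Fin (suc (suc k)) → ℚ
  term v i = f (v i) * ΠFin (suc k) (λ j → v (punchIn i j) - v i) ⁻¹
  swap-first-factors : ∀ {k} (v : Fin (suc (suc k)) → ℚ) (i : Fin k) →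
    ΠFin (suc k) (λ j → (v (suc zero) ∷ v ∘ punchIn (suc zero)) (punchIn (suc (suc i)) j) - v (suc (suc i)))
    ≡ ΠFin (suc k) (λ j → v (punchIn (suc (suc i)) j) - v (suc (suc i)))
  swap-first-factors {suc k} v i =
    x*yz≡y*xz (v (suc zero) - v (suc (suc i))) (v zero - v (suc (suc i)))
              (ΠFin k (λ j → v (suc (suc (punchIn i j))) - v (suc (suc i))))
  later-node : ∀ i → term r′ (suc (suc i)) ≡ term r (suc (suc i))
  later-node i = cong (λ t → f (r (suc (suc i))) * t ⁻¹) (swap-first-factors r i)

divDiff-factor : ∀ k h (r : Fin (suc (suc k)) → ℚ) → (∀ i → r (suc i) ≢ r zero) →
                 divDiff (suc k) (λ z → (z - r zero) * h z) r ≡ - divDiff k h (r ∘ suc)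
divDiff-factor k h r r≢r₀ = begin
  (r₀ - r₀) * h r₀ * nodeWeight (suc k) r zero
    + ΣFin (suc k) (λ i → (r (suc i) - r₀) * h (r (suc i)) * nodeWeight (suc k) r (suc i))
    ≡⟨ cong₂ _+_ ([a-a]*y*w≡0 r₀ (h r₀) _) (ΣFin-cong (suc k) (λ i → cancel-factor (h (r (suc i))) (P i) (r≢r₀ i))) ⟩
  0ℚ + ΣFin (suc k) (λ i → - (h (r (suc i)) * nodeWeight k (r ∘ suc) i))
    ≡⟨ +-identityˡ _ ⟩
  ΣFin (suc k) (λ i → - (h (r (suc i)) * nodeWeight k (r ∘ suc) i))
    ≡⟨ ΣFin-neg (suc k) (λ i → h (r (suc i)) * nodeWeight k (r ∘ suc) i) ⟩
  - divDiff k h (r ∘ suc) ∎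
  where
  r₀ = r zero
  P : Fin (suc k) → ℚ
  P i = ΠFin k (λ j → r (suc (punchIn i j)) - r (suc i))
  [a-a]*y*w≡0 : ∀ a y w → (a - a) * y * w ≡ 0ℚ
  [a-a]*y*w≡0 = solve-∀ ℚ-ring
  cancel-factor : ∀ {x} y P → x ≢ r₀ → (x - r₀) * y * ((r₀ - x) * P) ⁻¹ ≡ - (y * P ⁻¹)
  cancel-factor {x} y P x≢r₀ = begin
    (x - r₀) * y * ((r₀ - x) * P) ⁻¹          ≡⟨ cong ((x - r₀) * y *_) (⁻¹-distrib-* (r₀ - x) P) ⟩
    (x - r₀) * y * ((r₀ - x) ⁻¹ * P ⁻¹)       ≡⟨ *-interchange (x - r₀) y ((r₀ - x) ⁻¹) (P ⁻¹) ⟩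
    ((x - r₀) * (r₀ - x) ⁻¹) * (y * P ⁻¹)     ≡⟨ cong (_* (y * P ⁻¹)) ([x-y]*[y-x]⁻¹≡-1 x≢r₀) ⟩
    - 1ℚ * (y * P ⁻¹)                         ≡⟨ -1*x≈-x (y * P ⁻¹) ⟩
    - (y * P ⁻¹)                              ∎

divDiff-recurrence : ∀ k f (r : Fin (suc (suc k)) → ℚ) → Injective _≡_ _≡_ r →
  (r (suc zero) - r zero) * divDiff (suc k) f r
    ≡ divDiff k f (r ∘ punchIn (suc zero)) - divDiff k f (r ∘ suc)
divDiff-recurrence k f r inj = begin
  (r₁ - r₀) * divDiff (suc k) f r
    ≡⟨ sym (divDiff-*ˡ (suc k) (r₁ - r₀) f r) ⟩
  divDiff (suc k) (λ z → (r₁ - r₀) * f z) r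
    ≡⟨ divDiff-cong (suc k) r (λ z → difference-of-factors r₀ r₁ z (f z)) ⟩
  divDiff (suc k) (λ z → (z - r₀) * f z + - 1ℚ * ((z - r₁) * f z)) r
    ≡⟨ divDiff-+ (suc k) (λ z → (z - r₀) * f z) (λ z → - 1ℚ * ((z - r₁) * f z)) r ⟩
  divDiff (suc k) (λ z → (z - r₀) * f z) r + divDiff (suc k) (λ z → - 1ℚ * ((z - r₁) * f z)) r
    ≡⟨ cong (divDiff (suc k) (λ z → (z - r₀) * f z) r +_) (divDiff-*ˡ (suc k) (- 1ℚ) (λ z → (z - r₁) * f z) r) ⟩
  divDiff (suc k) (λ z → (z - r₀) * f z) r + - 1ℚ * divDiff (suc k) (λ z → (z - r₁) * f z) r
    ≡⟨ cong₂ (λ a b → a + - 1ℚ * b) factor₀ factor₁ ⟩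
  - divDiff k f (r ∘ suc) + - 1ℚ * - divDiff k f (r ∘ punchIn (suc zero))
    ≡⟨ rearrange (divDiff k f (r ∘ suc)) (divDiff k f (r ∘ punchIn (suc zero))) ⟩
  divDiff k f (r ∘ punchIn (suc zero)) - divDiff k f (r ∘ suc) ∎
  where
  r₀ = r zero
  r₁ = r (suc zero)
  difference-of-factors : ∀ a b z y → (b - a) * y ≡ (z - a) * y + - 1ℚ * ((z - b) * y)
  difference-of-factors = solve-∀ ℚ-ring
  rearrange : ∀ a b → - a + - 1ℚ * - b ≡ b - a
  rearrange = solve-∀ ℚ-ring
  factor₀ : divDiff (suc k) (λ z → (z - r₀) * f z) r ≡ - divDiff k f (r ∘ suc)
  factor₀ = divDiff-factor k f r (λ i → punchInᵢ≢i zero i ∘ inj)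
  factor₁ : divDiff (suc k) (λ z → (z - r₁) * f z) r ≡ - divDiff k f (r ∘ punchIn (suc zero))
  factor₁ = trans (sym (divDiff-swap k (λ z → (z - r₁) * f z) r))
                  (divDiff-factor k f (r₁ ∷ r ∘ punchIn (suc zero)) (λ i → punchInᵢ≢i (suc zero) i ∘ inj))

divDiff-one : ∀ k (r : Fin (suc (suc k)) → ℚ) → Injective _≡_ _≡_ r → divDiff (suc k) (λ _ → 1ℚ) r ≡ 0ℚ
divDiff-one k r inj = *-cancelˡ-≡0 (x-y≢0 (punchInᵢ≢i zero zero ∘ inj))
  (trans (divDiff-recurrence k (λ _ → 1ℚ) r inj) (lower-order-agree k r inj))
  where
  lower-order-agree : ∀ k (r : Fin (suc (suc k)) → ℚ) → Injective _≡_ _≡_ r →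
    divDiff k (λ _ → 1ℚ) (r ∘ punchIn (suc zero)) - divDiff k (λ _ → 1ℚ) (r ∘ suc) ≡ 0ℚ
  lower-order-agree zero    r inj = +-inverseʳ (divDiff zero (λ _ → 1ℚ) (r ∘ suc))
  lower-order-agree (suc k) r inj = cong₂ _-_
    (divDiff-one k (r ∘ punchIn (suc zero)) (punchIn-injective (suc zero) _ _ ∘ inj))
    (divDiff-one k (r ∘ suc) (suc-injective ∘ inj))

divDiff-vanishes : ∀ d k f (r : Fin (suc k) → ℚ) → Injective _≡_ _≡_ r → Deg≤ d f → d ℕ.< k →
                   divDiff k f r ≡ 0ℚ
divDiff-vanishes zero (suc k) f r inj df _ = begin
  divDiff (suc k) f r
    ≡⟨ divDiff-cong (suc k) r (λ z → trans (df z (r zero)) (sym (*-identityʳ (f (r zero))))) ⟩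
  divDiff (suc k) (λ _ → f (r zero) * 1ℚ) r ≡⟨ divDiff-*ˡ (suc k) (f (r zero)) (λ _ → 1ℚ) r ⟩
  f (r zero) * divDiff (suc k) (λ _ → 1ℚ) r ≡⟨ cong (f (r zero) *_) (divDiff-one k r inj) ⟩
  f (r zero) * 0ℚ                           ≡⟨ *-zeroʳ (f (r zero)) ⟩
  0ℚ                                        ∎
divDiff-vanishes (suc d) (suc k) f r inj df (s≤s d<k) with df (r zero)
... | g , dg , f≡ = begin
  divDiff (suc k) f r
    ≡⟨ divDiff-cong (suc k) r (λ z → trans (f≡ z) (cong (_+ (z - r₀) * g z) (sym (*-identityʳ (f r₀))))) ⟩
  divDiff (suc k) (λ z → f r₀ * 1ℚ + (z - r₀) * g z) r
    ≡⟨ divDiff-+ (suc k) (λ _ → f r₀ * 1ℚ) (λ z → (z - r₀) * g z) r ⟩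
  divDiff (suc k) (λ _ → f r₀ * 1ℚ) r + divDiff (suc k) (λ z → (z - r₀) * g z) r
    ≡⟨ cong₂ _+_ (divDiff-vanishes zero (suc k) (λ _ → f r₀ * 1ℚ) r inj (λ _ _ → refl) (s≤s z≤n))
                 (divDiff-factor k g r (λ i → punchInᵢ≢i zero i ∘ inj)) ⟩
  0ℚ + - divDiff k g (r ∘ suc)
    ≡⟨ cong (λ t → 0ℚ + - t) (divDiff-vanishes d k g (r ∘ suc) (suc-injective ∘ inj) dg d<k) ⟩
  0ℚ ∎
  where r₀ = r zero

Σ≤-cong : ∀ n {f g : ℕ → ℚ} → (∀ k → k ≤ n → f k ≡ g k) → Σ≤ n f ≡ Σ≤ n g
Σ≤-cong zero    f≗g = f≗g 0 z≤n
Σ≤-cong (suc n) f≗g = cong₂ _+_ (Σ≤-cong n (λ k k≤n → f≗g k (ℕ.m≤n⇒m≤1+n k≤n))) (f≗g (suc n) ℕ.≤-refl)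

Σ≤-+ : ∀ n (f g : ℕ → ℚ) → Σ≤ n (λ k → f k + g k) ≡ Σ≤ n f + Σ≤ n g
Σ≤-+ zero    f g = refl
Σ≤-+ (suc n) f g = trans (cong (_+ (f (suc n) + g (suc n))) (Σ≤-+ n f g)) (+-interchange (Σ≤ n f) (Σ≤ n g) _ _)

Σ≤-*ˡ : ∀ n c (f : ℕ → ℚ) → Σ≤ n (λ k → c * f k) ≡ c * Σ≤ n f
Σ≤-*ˡ zero    c f = refl
Σ≤-*ˡ (suc n) c f = trans (cong (_+ c * f (suc n)) (Σ≤-*ˡ n c f)) (sym (*-distribˡ-+ c (Σ≤ n f) (f (suc n))))

Σ≤-suc : ∀ n (f : ℕ → ℚ) → Σ≤ (suc n) f ≡ f 0 + Σ≤ n (f ∘ suc)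
Σ≤-suc zero    f = refl
Σ≤-suc (suc n) f = trans (cong (_+ f (suc (suc n))) (Σ≤-suc n f)) (+-assoc (f 0) (Σ≤ n (f ∘ suc)) _)

-- On exponential generating functions, differentiation shifts the coefficients.
∂ : EGF → EGF
∂ a n = a (suc n)

_⊕_ : EGF → EGF → EGF
(a ⊕ b) n = a n + b n

_·_ : ℚ → EGF → EGF
(c · a) n = c * a n

-- dilate c a is the series of t ↦ a (c t).
dilate : ℚ → EGF → EGF
dilate c a n = (c ^ n) * a n

⊛-cong : ∀ {a a′ b b′} → a ≗ a′ → b ≗ b′ → a ⊛ b ≗ a′ ⊛ b′
⊛-cong a≗a′ b≗b′ n = Σ≤-cong n (λ k _ → cong (ℕtoℚ (n C k) *_) (cong₂ _*_ (a≗a′ k) (b≗b′ (n ∸ k))))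

⊛-congˡ : ∀ {a a′} b → a ≗ a′ → a ⊛ b ≗ a′ ⊛ b
⊛-congˡ {a} {a′} b a≗a′ = ⊛-cong {a} {a′} {b} {b} a≗a′ (λ _ → refl)

⊛-congʳ : ∀ a {b b′} → b ≗ b′ → a ⊛ b ≗ a ⊛ b′
⊛-congʳ a {b} {b′} b≗b′ = ⊛-cong {a} {a} {b} {b′} (λ _ → refl) b≗b′

⊛-zero : ∀ a b → (a ⊛ b) 0 ≡ a 0 * b 0
⊛-zero a b = *-identityˡ (a 0 * b 0)

⊛-distribʳ-⊕ : ∀ a a′ b → (a ⊕ a′) ⊛ b ≗ (a ⊛ b) ⊕ (a′ ⊛ b)
⊛-distribʳ-⊕ a a′ b n = trans (Σ≤-cong n (λ k _ → distrib (ℕtoℚ (n C k)) (a k) (a′ k) (b (n ∸ k))))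
                               (Σ≤-+ n _ _)
  where
  distrib : ∀ c x y z → c * ((x + y) * z) ≡ c * (x * z) + c * (y * z)
  distrib = solve-∀ ℚ-ring

⊛-distribˡ-⊕ : ∀ a b b′ → a ⊛ (b ⊕ b′) ≗ (a ⊛ b) ⊕ (a ⊛ b′)
⊛-distribˡ-⊕ a b b′ n = trans (Σ≤-cong n (λ k _ → distrib (ℕtoℚ (n C k)) (a k) (b (n ∸ k)) (b′ (n ∸ k))))
                               (Σ≤-+ n _ _)
  where
  distrib : ∀ c x y z → c * (x * (y + z)) ≡ c * (x * y) + c * (x * z)
  distrib = solve-∀ ℚ-ring

⊛-·ˡ : ∀ c a b → (c · a) ⊛ b ≗ c · (a ⊛ b)
⊛-·ˡ c a b n = trans (Σ≤-cong n (λ k _ → pull (ℕtoℚ (n C k)) c (a k) (b (n ∸ k)))) (Σ≤-*ˡ n c _)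
  where
  pull : ∀ d c x y → d * ((c * x) * y) ≡ c * (d * (x * y))
  pull = solve-∀ ℚ-ring

⊛-·ʳ : ∀ c a b → a ⊛ (c · b) ≗ c · (a ⊛ b)
⊛-·ʳ c a b n = trans (Σ≤-cong n (λ k _ → pull (ℕtoℚ (n C k)) c (a k) (b (n ∸ k)))) (Σ≤-*ˡ n c _)
  where
  pull : ∀ d c x y → d * (x * (c * y)) ≡ c * (d * (x * y))
  pull = solve-∀ ℚ-ring

⊛-leibniz : ∀ a b → ∂ (a ⊛ b) ≗ (∂ a ⊛ b) ⊕ (a ⊛ ∂ b)
⊛-leibniz a b n = begin
  Σ≤ (suc n) F                                            ≡⟨ Σ≤-suc n F ⟩
  F 0 + Σ≤ n (F ∘ suc)                                    ≡⟨ cong (F 0 +_) pascal ⟩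
  F 0 + ((∂ a ⊛ b) n + Σ≤ n (G ∘ suc))                    ≡⟨ x+yz≡y+xz (F 0) ((∂ a ⊛ b) n) _ ⟩
  (∂ a ⊛ b) n + (G 0 + Σ≤ n (G ∘ suc))                    ≡⟨ cong ((∂ a ⊛ b) n +_) (sym (Σ≤-suc n G)) ⟩
  (∂ a ⊛ b) n + (Σ≤ n G + G (suc n))                      ≡⟨ cong ((∂ a ⊛ b) n +_) (cong₂ _+_ first-terms last-term) ⟩
  (∂ a ⊛ b) n + ((a ⊛ ∂ b) n + 0ℚ)                        ≡⟨ cong ((∂ a ⊛ b) n +_) (+-identityʳ _) ⟩
  (∂ a ⊛ b) n + (a ⊛ ∂ b) n                               ∎
  where
  F G : ℕ → ℚ
  F k = ℕtoℚ (suc n C k) * (a k * b (suc n ∸ k))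
  G k = ℕtoℚ (n C k) * (a k * b (suc n ∸ k))
  pascal : Σ≤ n (F ∘ suc) ≡ (∂ a ⊛ b) n + Σ≤ n (G ∘ suc)
  pascal = trans (Σ≤-cong n (λ k _ → let t = a (suc k) * b (n ∸ k) in begin
      F (suc k)                               ≡⟨ cong (λ c → ℕtoℚ c * t) (sym (nCk+nC[k+1]≡[n+1]C[k+1] n k)) ⟩
      ℕtoℚ (n C k ℕ.+ n C suc k) * t          ≡⟨ cong (_* t) (ℕtoℚ-+ (n C k) (n C suc k)) ⟩
      (ℕtoℚ (n C k) + ℕtoℚ (n C suc k)) * t   ≡⟨ *-distribʳ-+ t (ℕtoℚ (n C k)) _ ⟩
      ℕtoℚ (n C k) * t + G (suc k)            ∎))
    (Σ≤-+ n _ (G ∘ suc))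
  first-terms : Σ≤ n G ≡ (a ⊛ ∂ b) n
  first-terms = Σ≤-cong n (λ k k≤n → cong (λ i → ℕtoℚ (n C k) * (a k * b i)) (ℕ.+-∸-assoc 1 k≤n))
  last-term : G (suc n) ≡ 0ℚ
  last-term = let t = a (suc n) * b (n ∸ n) in
    trans (cong (λ c → ℕtoℚ c * t) (k>n⇒nCk≡0 (ℕ.n<1+n n))) (*-zeroˡ t)

⊛-comm : ∀ a b → a ⊛ b ≗ b ⊛ a
⊛-comm a b zero    = trans (⊛-zero a b) (trans (*-comm (a 0) (b 0)) (sym (⊛-zero b a)))
⊛-comm a b (suc n) = begin
  (a ⊛ b) (suc n)               ≡⟨ ⊛-leibniz a b n ⟩
  (∂ a ⊛ b) n + (a ⊛ ∂ b) n     ≡⟨ cong₂ _+_ (⊛-comm (∂ a) b n) (⊛-comm a (∂ b) n) ⟩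
  (b ⊛ ∂ a) n + (∂ b ⊛ a) n     ≡⟨ +-comm ((b ⊛ ∂ a) n) _ ⟩
  (∂ b ⊛ a) n + (b ⊛ ∂ a) n     ≡⟨ sym (⊛-leibniz b a n) ⟩
  (b ⊛ a) (suc n)               ∎

⊛-assoc : ∀ a b c → (a ⊛ b) ⊛ c ≗ a ⊛ (b ⊛ c)
⊛-assoc a b c zero = begin
  ((a ⊛ b) ⊛ c) 0       ≡⟨ trans (⊛-zero (a ⊛ b) c) (cong (_* c 0) (⊛-zero a b)) ⟩
  (a 0 * b 0) * c 0     ≡⟨ *-assoc (a 0) (b 0) (c 0) ⟩
  a 0 * (b 0 * c 0)     ≡⟨ sym (trans (⊛-zero a (b ⊛ c)) (cong (a 0 *_) (⊛-zero b c))) ⟩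
  (a ⊛ (b ⊛ c)) 0       ∎
⊛-assoc a b c (suc n) = begin
  ((a ⊛ b) ⊛ c) (suc n)
    ≡⟨ ⊛-leibniz (a ⊛ b) c n ⟩
  (∂ (a ⊛ b) ⊛ c) n + ((a ⊛ b) ⊛ ∂ c) n
    ≡⟨ cong (_+ ((a ⊛ b) ⊛ ∂ c) n)
            (trans (⊛-congˡ c (⊛-leibniz a b) n) (⊛-distribʳ-⊕ (∂ a ⊛ b) (a ⊛ ∂ b) c n)) ⟩
  (((∂ a ⊛ b) ⊛ c) n + ((a ⊛ ∂ b) ⊛ c) n) + ((a ⊛ b) ⊛ ∂ c) n
    ≡⟨ cong₂ _+_ (cong₂ _+_ (⊛-assoc (∂ a) b c n) (⊛-assoc a (∂ b) c n)) (⊛-assoc a b (∂ c) n) ⟩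
  ((∂ a ⊛ (b ⊛ c)) n + (a ⊛ (∂ b ⊛ c)) n) + (a ⊛ (b ⊛ ∂ c)) n
    ≡⟨ +-assoc (((∂ a ⊛ (b ⊛ c))) n) _ _ ⟩
  (∂ a ⊛ (b ⊛ c)) n + ((a ⊛ (∂ b ⊛ c)) n + (a ⊛ (b ⊛ ∂ c)) n)
    ≡⟨ cong ((∂ a ⊛ (b ⊛ c)) n +_)
            (sym (trans (⊛-congʳ a (⊛-leibniz b c) n) (⊛-distribˡ-⊕ a (∂ b ⊛ c) (b ⊛ ∂ c) n))) ⟩
  (∂ a ⊛ (b ⊛ c)) n + (a ⊛ ∂ (b ⊛ c)) n
    ≡⟨ sym (⊛-leibniz a (b ⊛ c) n) ⟩
  (a ⊛ (b ⊛ c)) (suc n) ∎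

⊛-swapˡ : ∀ a b c → a ⊛ (b ⊛ c) ≗ b ⊛ (a ⊛ c)
⊛-swapˡ a b c n = begin
  (a ⊛ (b ⊛ c)) n    ≡⟨ sym (⊛-assoc a b c n) ⟩
  ((a ⊛ b) ⊛ c) n    ≡⟨ ⊛-congˡ c (⊛-comm a b) n ⟩
  ((b ⊛ a) ⊛ c) n    ≡⟨ ⊛-assoc b a c n ⟩
  (b ⊛ (a ⊛ c)) n    ∎

⊛-identityˡ : ∀ u a → u 0 ≡ 1ℚ → (∀ k → u (suc k) ≡ 0ℚ) → u ⊛ a ≗ a
⊛-identityˡ u a u₀≡1 ∂u≡0 zero    = trans (⊛-zero u a) (trans (cong (_* a 0) u₀≡1) (*-identityˡ (a 0)))
⊛-identityˡ u a u₀≡1 ∂u≡0 (suc n) = begin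
  (u ⊛ a) (suc n)               ≡⟨ ⊛-leibniz u a n ⟩
  (∂ u ⊛ a) n + (u ⊛ ∂ a) n     ≡⟨ cong₂ _+_ ∂u⊛a≡0 (⊛-identityˡ u (∂ a) u₀≡1 ∂u≡0 n) ⟩
  0ℚ + a (suc n)                ≡⟨ +-identityˡ (a (suc n)) ⟩
  a (suc n)                     ∎
  where
  ∂u⊛a≡0 : (∂ u ⊛ a) n ≡ 0ℚ
  ∂u⊛a≡0 = begin
    (∂ u ⊛ a) n
      ≡⟨ ⊛-congˡ {∂ u} {0ℚ · ∂ u} a (λ k → trans (∂u≡0 k) (sym (*-zeroˡ (∂ u k)))) n ⟩
    ((0ℚ · ∂ u) ⊛ a) n          ≡⟨ ⊛-·ˡ 0ℚ (∂ u) a n ⟩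
    0ℚ * (∂ u ⊛ a) n            ≡⟨ *-zeroˡ ((∂ u ⊛ a) n) ⟩
    0ℚ                          ∎

dilate-⊛ : ∀ c a b → dilate c (a ⊛ b) ≗ dilate c a ⊛ dilate c b
dilate-⊛ c a b zero    = begin
  1ℚ * (a ⊛ b) 0                       ≡⟨ trans (*-identityˡ _) (⊛-zero a b) ⟩
  a 0 * b 0                            ≡⟨ sym (cong₂ _*_ (*-identityˡ (a 0)) (*-identityˡ (b 0))) ⟩
  (1ℚ * a 0) * (1ℚ * b 0)              ≡⟨ sym (⊛-zero (dilate c a) (dilate c b)) ⟩
  (dilate c a ⊛ dilate c b) 0          ∎
dilate-⊛ c a b (suc n) = begin
  (c * c ^ n) * (a ⊛ b) (suc n)
    ≡⟨ cong ((c * c ^ n) *_) (⊛-leibniz a b n) ⟩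
  (c * c ^ n) * ((∂ a ⊛ b) n + (a ⊛ ∂ b) n)
    ≡⟨ distrib c (c ^ n) ((∂ a ⊛ b) n) ((a ⊛ ∂ b) n) ⟩
  c * dilate c (∂ a ⊛ b) n + c * dilate c (a ⊛ ∂ b) n
    ≡⟨ cong₂ (λ x y → c * x + c * y) (dilate-⊛ c (∂ a) b n) (dilate-⊛ c a (∂ b) n) ⟩
  c * (dilate c (∂ a) ⊛ dilate c b) n + c * (dilate c a ⊛ dilate c (∂ b)) n
    ≡⟨ cong₂ _+_ (sym (⊛-·ˡ c (dilate c (∂ a)) (dilate c b) n)) (sym (⊛-·ʳ c (dilate c a) (dilate c (∂ b)) n)) ⟩
  ((c · dilate c (∂ a)) ⊛ dilate c b) n + (dilate c a ⊛ (c · dilate c (∂ b))) n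
    ≡⟨ cong₂ _+_
         (⊛-congˡ {c · dilate c (∂ a)} {∂ (dilate c a)} (dilate c b) (λ k → sym (*-assoc c (c ^ k) (a (suc k)))) n)
         (⊛-congʳ (dilate c a) {c · dilate c (∂ b)} {∂ (dilate c b)} (λ k → sym (*-assoc c (c ^ k) (b (suc k)))) n) ⟩
  (∂ (dilate c a) ⊛ dilate c b) n + (dilate c a ⊛ ∂ (dilate c b)) n
    ≡⟨ sym (⊛-leibniz (dilate c a) (dilate c b) n) ⟩
  (dilate c a ⊛ dilate c b) (suc n) ∎
  where
  distrib : ∀ c cⁿ x y → (c * cⁿ) * (x + y) ≡ c * (cⁿ * x) + c * (cⁿ * y)
  distrib = solve-∀ ℚ-ring

bernEGF-0-identity : ∀ a → bernEGF 0ℚ ⊛ a ≗ a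
bernEGF-0-identity a = ⊛-identityˡ (bernEGF 0ℚ) a refl
  (λ k → trans (cong (_* bernoulli (suc k)) (*-zeroˡ (0ℚ ^ k))) (*-zeroˡ (bernoulli (suc k))))

bernEGF-* : ∀ c x → bernEGF (c * x) ≗ dilate c (bernEGF x)
bernEGF-* c x k = trans (cong (_* bernoulli k) (^-distrib-* k c x)) (*-assoc (c ^ k) (x ^ k) (bernoulli k))

higherBernoulli-cong : ∀ m {s s′} {e e′ : Fin m → ℚ} → s ≡ s′ → e ≗ e′ →
                       higherBernoulliEGF m s e ≗ higherBernoulliEGF m s′ e′
higherBernoulli-cong zero    s≡s′ e≗e′ n = cong (_^ n) s≡s′
higherBernoulli-cong (suc m) {s} {s′} {e} {e′} s≡s′ e≗e′ =
  ⊛-cong {bernEGF (e zero)} {bernEGF (e′ zero)} (λ k → cong (λ x → (x ^ k) * bernoulli k) (e≗e′ zero))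
         (higherBernoulli-cong m s≡s′ (e≗e′ ∘ suc))

higherBernoulli-homogeneous : ∀ m c s (e : Fin m → ℚ) →
  higherBernoulliEGF m (c * s) (λ j → c * e j) ≗ dilate c (higherBernoulliEGF m s e)
higherBernoulli-homogeneous zero    c s e n = ^-distrib-* n c s
higherBernoulli-homogeneous (suc m) c s e n = begin
  (bernEGF (c * e zero) ⊛ higherBernoulliEGF m (c * s) (λ j → c * e (suc j))) n
    ≡⟨ ⊛-cong (bernEGF-* c (e zero)) (higherBernoulli-homogeneous m c s (e ∘ suc)) n ⟩
  (dilate c (bernEGF (e zero)) ⊛ dilate c (higherBernoulliEGF m s (e ∘ suc))) n
    ≡⟨ sym (dilate-⊛ c (bernEGF (e zero)) (higherBernoulliEGF m s (e ∘ suc)) n) ⟩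
  dilate c (bernEGF (e zero) ⊛ higherBernoulliEGF m s (e ∘ suc)) n ∎

higherBernoulli-punchIn : ∀ m s (e : Fin (suc m) → ℚ) i →
  higherBernoulliEGF (suc m) s e ≗ higherBernoulliEGF (suc m) s (e i ∷ e ∘ punchIn i)
higherBernoulli-punchIn m       s e zero    n = refl
higherBernoulli-punchIn (suc m) s e (suc i) n = begin
  (β (e zero) ⊛ higherBernoulliEGF (suc m) s (e ∘ suc)) n
    ≡⟨ ⊛-congʳ (β (e zero)) (higherBernoulli-punchIn m s (e ∘ suc) i) n ⟩
  (β (e zero) ⊛ (β (e (suc i)) ⊛ higherBernoulliEGF m s (e ∘ suc ∘ punchIn i))) n
    ≡⟨ ⊛-swapˡ (β (e zero)) (β (e (suc i))) (higherBernoulliEGF m s (e ∘ suc ∘ punchIn i)) n ⟩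
  (β (e (suc i)) ⊛ (β (e zero) ⊛ higherBernoulliEGF m s (e ∘ suc ∘ punchIn i))) n ∎
  where β = bernEGF

higherBernoulli-0∷ : ∀ m s (e : Fin m → ℚ) → higherBernoulliEGF (suc m) s (0ℚ ∷ e) ≗ higherBernoulliEGF m s e
higherBernoulli-0∷ m s e = bernEGF-0-identity (higherBernoulliEGF m s e)

Graded : (ℚ → EGF) → Set
Graded A = ∀ n → Deg≤ n (λ z → A z n)

⊛-graded : ∀ {A B} → Graded A → Graded B → Graded (λ z → A z ⊛ B z)
⊛-graded {A} {B} gA gB n = Deg≤-Σ≤ n n _ (λ k k≤n →
  Deg≤-*ˡ n (ℕtoℚ (n C k))
    (Deg≤-mono (ℕ.≤-reflexive (ℕ.m+[n∸m]≡n k≤n)) (Deg≤-* k (n ∸ k) (gA k) (gB (n ∸ k)))))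

expEGF-graded : ∀ {S} → Deg≤ 1 S → Graded (λ z → expEGF (S z))
expEGF-graded dS n = Deg≤-^ n dS

bernEGF-graded : ∀ {x} → Deg≤ 1 x → Graded (λ z → bernEGF (x z))
bernEGF-graded {x} dx n = Deg≤-cong n (λ z → *-comm (bernoulli n) (x z ^ n)) (Deg≤-*ˡ n (bernoulli n) (Deg≤-^ n dx))

higherBernoulli-graded : ∀ m {S} {e : ℚ → Fin m → ℚ} → Deg≤ 1 S → (∀ j → Deg≤ 1 (λ z → e z j)) →
                         Graded (λ z → higherBernoulliEGF m (S z) (e z))
higherBernoulli-graded zero    dS de = expEGF-graded dS
higherBernoulli-graded (suc m) dS de =
  ⊛-graded (bernEGF-graded (de zero)) (higherBernoulli-graded m dS (de ∘ suc))

Bσ : ∀ m → ℕ → ℚ → (Fin m → ℚ) → ℚ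
Bσ m n s e = higherBernoulliEGF m (s + σ₁ m e) e n

Bσ-cong : ∀ m n {s s′} {e e′ : Fin m → ℚ} → s ≡ s′ → e ≗ e′ → Bσ m n s e ≡ Bσ m n s′ e′
Bσ-cong m n s≡s′ e≗e′ = higherBernoulli-cong m (cong₂ _+_ s≡s′ (ΣFin-cong m e≗e′)) e≗e′ n

Bσ-punchIn : ∀ m n s (e : Fin (suc m) → ℚ) i → Bσ (suc m) n s e ≡ Bσ (suc m) n s (e i ∷ e ∘ punchIn i)
Bσ-punchIn m n s e i = trans (higherBernoulli-punchIn m (s + σ₁ (suc m) e) e i n)
  (higherBernoulli-cong (suc m) {e = e i ∷ e ∘ punchIn i} (cong (s +_) (ΣFin-punchIn m e i)) (λ _ → refl) n)

Bσ-0∷ : ∀ m n s (e : Fin m → ℚ) → Bσ (suc m) n s (0ℚ ∷ e) ≡ Bσ m n s e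
Bσ-0∷ m n s e = trans (higherBernoulli-0∷ m (s + (0ℚ + σ₁ m e)) e n)
  (higherBernoulli-cong m {e = e} (cong (s +_) (+-identityˡ (σ₁ m e))) (λ _ → refl) n)

Bσ-homogeneous : ∀ m n c s (e : Fin m → ℚ) → Bσ m n (c * s) (λ j → c * e j) ≡ (c ^ n) * Bσ m n s e
Bσ-homogeneous m n c s e = trans
  (higherBernoulli-cong m {e = λ j → c * e j}
     (trans (cong (c * s +_) (ΣFin-*ˡ m c e)) (sym (*-distribˡ-+ c s (σ₁ m e)))) (λ _ → refl) n)
  (higherBernoulli-homogeneous m c (s + σ₁ m e) e n)

module Decomposition {m′ : ℕ} (s : ℚ) (d δ : Fin (suc m′) → ℚ) (D : Fin (suc m′) → Fin (suc m′) → ℚ)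
  (d≢0 : ∀ i → d i ≢ 0ℚ) (δ≢0 : ∀ i → δ i ≢ 0ℚ)
  (δd≢δd : ∀ i j → i ≢ j → δ i * d j ≢ δ j * d i)
  (D-diag : ∀ i → D i i ≡ d i) (D-off : ∀ i j → i ≢ j → D i j ≡ δ i * d j - δ j * d i)
  where

  m = suc m′

  ρ : Fin m → ℚ
  ρ i = d i * δ i ⁻¹

  δρ≡d : ∀ i → δ i * ρ i ≡ d i
  δρ≡d i = begin
    δ i * (d i * δ i ⁻¹)   ≡⟨ x*yz≡y*xz (δ i) (d i) (δ i ⁻¹) ⟩
    d i * (δ i * δ i ⁻¹)   ≡⟨ cong (d i *_) (⁻¹-inverseʳ (δ≢0 i)) ⟩
    d i * 1ℚ               ≡⟨ *-identityʳ (d i) ⟩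
    d i                    ∎

  ρ≢0 : ∀ i → ρ i ≢ 0ℚ
  ρ≢0 i ρ≡0 = d≢0 i (trans (sym (δρ≡d i)) (trans (cong (δ i *_) ρ≡0) (*-zeroʳ (δ i))))

  ρ-injective : Injective _≡_ _≡_ ρ
  ρ-injective {i} {j} ρi≡ρj with i Fin.≟ j
  ... | yes i≡j = i≡j
  ... | no  i≢j = ⊥-elim (δd≢δd i j i≢j (begin
    δ i * d j              ≡⟨ cong (δ i *_) (sym (δρ≡d j)) ⟩
    δ i * (δ j * ρ j)      ≡⟨ cong (λ x → δ i * (δ j * x)) (sym ρi≡ρj) ⟩
    δ i * (δ j * ρ i)      ≡⟨ x*yz≡y*xz (δ i) (δ j) (ρ i) ⟩
    δ j * (δ i * ρ i)      ≡⟨ cong (δ j *_) (δρ≡d i) ⟩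
    δ j * d i              ∎))

  nodes : Fin (suc m) → ℚ
  nodes = 0ℚ ∷ ρ

  nodes-injective : Injective _≡_ _≡_ nodes
  nodes-injective {zero}  {zero}  _ = refl
  nodes-injective {zero}  {suc j} 0≡ρj = ⊥-elim (ρ≢0 j (sym 0≡ρj))
  nodes-injective {suc i} {zero}  ρi≡0 = ⊥-elim (ρ≢0 i ρi≡0)
  nodes-injective {suc i} {suc j} ρi≡ρj = cong suc (ρ-injective ρi≡ρj)

  -- params z = (z, d - z δ); at z = ρ i its entry d i - z δ i vanishes.
  params : ℚ → Fin (suc m) → ℚ
  params z = z ∷ λ j → δ j * (ρ j - z)

  N : ℚ → ℚ
  N z = Bσ (suc m) m′ s (params z)

  N-degree : Deg≤ m′ N
  N-degree = higherBernoulli-graded (suc m)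
    (Deg≤-+ 1 (Deg≤-const 1 s) (Deg≤-ΣFin 1 (suc m) params params-affine)) params-affine m′
    where
    δ[ρ-z]≡δρ+[-δ]z : ∀ δ ρ z → δ * (ρ - z) ≡ δ * ρ + (- δ) * z
    δ[ρ-z]≡δρ+[-δ]z = solve-∀ ℚ-ring
    params-affine : ∀ j → Deg≤ 1 (λ z → params z j)
    params-affine zero    = Deg≤-id
    params-affine (suc j) = Deg≤-cong 1 (λ z → sym (δ[ρ-z]≡δρ+[-δ]z (δ j) (ρ j) z)) (Deg≤-affine (δ j * ρ j) (- δ j))

  N-at-0 : N 0ℚ ≡ Bσ m m′ s d
  N-at-0 = trans (Bσ-0∷ m m′ s (λ j → δ j * (ρ j - 0ℚ)))
                 (Bσ-cong m m′ {s} refl (λ j → trans (cong (δ j *_) (+-identityʳ (ρ j))) (δρ≡d j)))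

  params-vanish : ∀ i → params (ρ i) (suc i) ≡ 0ℚ
  params-vanish i = trans (cong (δ i *_) (+-inverseʳ (ρ i))) (*-zeroʳ (δ i))

  reduced : Fin m → Fin m → ℚ
  reduced i = ρ i ∷ λ j → params (ρ i) (suc (punchIn i j))

  N-at-ρ : ∀ i → N (ρ i) ≡ Bσ m m′ s (reduced i)
  N-at-ρ i = begin
    N (ρ i)                                    ≡⟨ Bσ-punchIn m m′ s (params (ρ i)) (suc i) ⟩
    Bσ (suc m) m′ s (params (ρ i) (suc i) ∷ params (ρ i) ∘ punchIn (suc i))
                                               ≡⟨ Bσ-cong (suc m) m′ {s} refl rearranged ⟩
    Bσ (suc m) m′ s (0ℚ ∷ reduced i)           ≡⟨ Bσ-0∷ m m′ s (reduced i) ⟩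
    Bσ m m′ s (reduced i)                      ∎
    where
    rearranged : (params (ρ i) (suc i) ∷ params (ρ i) ∘ punchIn (suc i)) ≗ (0ℚ ∷ reduced i)
    rearranged zero          = params-vanish i
    rearranged (suc zero)    = refl
    rearranged (suc (suc j)) = refl

  D-entry : ∀ i j → D i (punchIn i j) ≡ δ i * params (ρ i) (suc (punchIn i j))
  D-entry i j = begin
    D i k                                 ≡⟨ D-off i k (punchInᵢ≢i i j ∘ sym) ⟩
    δ i * d k - δ k * d i                 ≡⟨ cong₂ (λ x y → δ i * x - δ k * y) (sym (δρ≡d k)) (sym (δρ≡d i)) ⟩
    δ i * (δ k * ρ k) - δ k * (δ i * ρ i) ≡⟨ factor (δ i) (δ k) (ρ k) (ρ i) ⟩
    δ i * (δ k * (ρ k - ρ i))             ∎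
    where
    k = punchIn i j
    factor : ∀ a b x y → a * (b * x) - b * (a * y) ≡ a * (b * (x - y))
    factor = solve-∀ ℚ-ring

  D≗δ*reduced : ∀ i → (D i i ∷ D i ∘ punchIn i) ≗ (λ j → δ i * reduced i j)
  D≗δ*reduced i zero    = trans (D-diag i) (sym (δρ≡d i))
  D≗δ*reduced i (suc j) = D-entry i j

  Bσ-D : ∀ i → Bσ m m′ (s * δ i) (D i) ≡ (δ i ^ m′) * Bσ m m′ s (reduced i)
  Bσ-D i = begin
    Bσ m m′ (s * δ i) (D i)                           ≡⟨ Bσ-punchIn m′ m′ (s * δ i) (D i) i ⟩
    Bσ m m′ (s * δ i) (D i i ∷ D i ∘ punchIn i)       ≡⟨ Bσ-cong m m′ (*-comm s (δ i)) (D≗δ*reduced i) ⟩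
    Bσ m m′ (δ i * s) (λ j → δ i * reduced i j)       ≡⟨ Bσ-homogeneous m m′ (δ i) s (reduced i) ⟩
    (δ i ^ m′) * Bσ m m′ s (reduced i)                ∎

  Δ : ℚ
  Δ = ΠFin m δ

  Δ≢0 : Δ ≢ 0ℚ
  Δ≢0 = ΠFin-≢0 m δ δ≢0

  Q : Fin m → ℚ
  Q i = ΠFin m′ (λ j → ρ (punchIn i j) - ρ i)

  π-d : πv m d ≡ Δ * ΠFin m (λ j → ρ j - 0ℚ)
  π-d = trans (ΠFin-cong m (λ j → trans (sym (δρ≡d j)) (cong (δ j *_) (sym (+-identityʳ (ρ j))))))
              (ΠFin-* m δ (λ j → ρ j - 0ℚ))

  π-D : ∀ i → πv m (D i) ≡ (δ i ^ m′) * (Δ * (ρ i * Q i))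
  π-D i = begin
    ΠFin m (D i)
      ≡⟨ ΠFin-punchIn m′ (D i) i ⟩
    D i i * ΠFin m′ (D i ∘ punchIn i)
      ≡⟨ cong₂ _*_ (D≗δ*reduced i zero) (ΠFin-cong m′ (D-entry i)) ⟩
    (δ i * ρ i) * ΠFin m′ (λ j → δ i * (δ (punchIn i j) * (ρ (punchIn i j) - ρ i)))
      ≡⟨ cong ((δ i * ρ i) *_) (trans (ΠFin-*ˡ m′ (δ i) _) (cong ((δ i ^ m′) *_) (ΠFin-* m′ (δ ∘ punchIn i) _))) ⟩
    (δ i * ρ i) * ((δ i ^ m′) * (ΠFin m′ (δ ∘ punchIn i) * Q i))
      ≡⟨ regroup (δ i) (ρ i) (δ i ^ m′) (ΠFin m′ (δ ∘ punchIn i)) (Q i) ⟩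
    (δ i ^ m′) * ((δ i * ΠFin m′ (δ ∘ punchIn i)) * (ρ i * Q i))
      ≡⟨ cong (λ x → (δ i ^ m′) * (x * (ρ i * Q i))) (sym (ΠFin-punchIn m′ δ i)) ⟩
    (δ i ^ m′) * (Δ * (ρ i * Q i)) ∎
    where
    regroup : ∀ a x c p q → (a * x) * (c * (p * q)) ≡ c * ((a * p) * (x * q))
    regroup = solve-∀ ℚ-ring

  term-at-0 : N 0ℚ * nodeWeight m nodes zero ≡ Δ * (Bσ m m′ s d /ℚ πv m d)
  term-at-0 = begin
    N 0ℚ * L ⁻¹                     ≡⟨ cong (_* L ⁻¹) N-at-0 ⟩
    X * L ⁻¹                        ≡⟨ sym (*-cancelˡ-⁻¹ X L Δ≢0) ⟩
    (Δ * X) * (Δ * L) ⁻¹            ≡⟨ *-assoc Δ X _ ⟩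
    Δ * (X * (Δ * L) ⁻¹)            ≡⟨ cong (λ p → Δ * (X * p ⁻¹)) (sym π-d) ⟩
    Δ * (X * πv m d ⁻¹)             ≡⟨ cong (Δ *_) (sym (/ℚ≡*⁻¹ X (πv m d))) ⟩
    Δ * (X /ℚ πv m d)               ∎
    where
    X = Bσ m m′ s d
    L = ΠFin m (λ j → ρ j - 0ℚ)

  term-at-ρ : ∀ i → N (ρ i) * nodeWeight m nodes (suc i) ≡ - (Δ * (Bσ m m′ (s * δ i) (D i) /ℚ πv m (D i)))
  term-at-ρ i = begin
    N (ρ i) * ((0ℚ - ρ i) * Q i) ⁻¹        ≡⟨ cong₂ (λ x y → x * y ⁻¹) (N-at-ρ i) ([0-x]*y≡-[x*y] (ρ i) (Q i)) ⟩
    R * (- (ρ i * Q i)) ⁻¹                  ≡⟨ cong (R *_) (⁻¹-neg (ρ i * Q i)) ⟩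
    R * - ((ρ i * Q i) ⁻¹)                  ≡⟨ sym (neg-distribʳ-* R _) ⟩
    - (R * (ρ i * Q i) ⁻¹)                  ≡⟨ cong -_ (sym (*-cancelˡ-⁻¹ R (ρ i * Q i) Δ≢0)) ⟩
    - ((Δ * R) * (Δ * (ρ i * Q i)) ⁻¹)      ≡⟨ cong -_ (*-assoc Δ R _) ⟩
    - (Δ * (R * (Δ * (ρ i * Q i)) ⁻¹))
                                            ≡⟨ cong (λ t → - (Δ * t)) (sym (*-cancelˡ-⁻¹ R _ (^-≢0 m′ (δ≢0 i)))) ⟩
    - (Δ * ((c * R) * (c * (Δ * (ρ i * Q i))) ⁻¹))
                                            ≡⟨ cong₂ (λ x y → - (Δ * (x * y ⁻¹))) (sym (Bσ-D i)) (sym (π-D i)) ⟩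
    - (Δ * (Y * πv m (D i) ⁻¹))             ≡⟨ cong (λ t → - (Δ * t)) (sym (/ℚ≡*⁻¹ Y (πv m (D i)))) ⟩
    - (Δ * (Y /ℚ πv m (D i)))               ∎
    where
    R = Bσ m m′ s (reduced i)
    Y = Bσ m m′ (s * δ i) (D i)
    c = δ i ^ m′
    [0-x]*y≡-[x*y] : ∀ x y → (0ℚ - x) * y ≡ - (x * y)
    [0-x]*y≡-[x*y] = solve-∀ ℚ-ring

  decomposition : Bσ m m′ s d /ℚ πv m d - ΣFin m (λ i → Bσ m m′ (s * δ i) (D i) /ℚ πv m (D i)) ≡ 0ℚ
  decomposition = *-cancelˡ-≡0 Δ≢0 (begin
    Δ * (T - ΣFin m Tᵢ)                   ≡⟨ distrib Δ T (ΣFin m Tᵢ) ⟩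
    Δ * T + - (Δ * ΣFin m Tᵢ)             ≡⟨ cong (λ x → Δ * T + - x) (sym (ΣFin-*ˡ m Δ Tᵢ)) ⟩
    Δ * T + - ΣFin m (λ i → Δ * Tᵢ i)     ≡⟨ cong (Δ * T +_) (sym (ΣFin-neg m (λ i → Δ * Tᵢ i))) ⟩
    Δ * T + ΣFin m (λ i → - (Δ * Tᵢ i))   ≡⟨ sym (cong₂ _+_ term-at-0 (ΣFin-cong m term-at-ρ)) ⟩
    divDiff m N nodes                     ≡⟨ divDiff-vanishes m′ m N nodes nodes-injective N-degree (ℕ.n<1+n m′) ⟩
    0ℚ                                    ∎)
    where
    T = Bσ m m′ s d /ℚ πv m d
    Tᵢ = λ i → Bσ m m′ (s * δ i) (D i) /ℚ πv m (D i)
    distrib : ∀ a x y → a * (x - y) ≡ a * x + - (a * y)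
    distrib = solve-∀ ℚ-ring

dvec-diag : ∀ m d δ i → dvec m d δ i i ≡ ℕtoℚ (d i)
dvec-diag m d δ i with toℕ i ℕ.≟ toℕ i
... | yes _   = refl
... | no  i≢i = ⊥-elim (i≢i refl)

dvec-off : ∀ m d δ i j → i ≢ j →
           dvec m d δ i j ≡ ℕtoℚ (δ i) * ℕtoℚ (d j) - ℕtoℚ (δ j) * ℕtoℚ (d i)
dvec-off m d δ i j i≢j with toℕ i ℕ.≟ toℕ j
... | yes i≡j = ⊥-elim (i≢j (toℕ-injective i≡j))
... | no  _   = trans (ℤtoℚ-sub (ℤ.+ (δ i ℕ.* d j)) (ℤ.+ (δ j ℕ.* d i)))
                      (cong₂ _-_ (ℕtoℚ-* (δ i) (d j)) (ℕtoℚ-* (δ j) (d i)))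

mainTheorem2 : (m : ℕ) → 1 Data.Nat.≤ m →
    (d δ : Fin m → ℕ) →
    (∀ i → 1 Data.Nat.≤ d i) → (∀ i → 1 Data.Nat.≤ δ i) →
    (∀ i → Coprime (δ i) (d i)) →
    (∀ i j → i ≢ j → δ i Data.Nat.* d j ≢ δ j Data.Nat.* d i) →
    (s : ℚ) →
    let dq = λ i → ℕtoℚ (d i) in
    ((B[ m ] (m Data.Nat.∸ 1)) (s + σ₁ m dq) dq /ℚ πv m dq)
      - ΣFin m (λ i →
          (B[ m ] (m Data.Nat.∸ 1)) (s * ℕtoℚ (δ i) + σ₁ m (dvec m d δ i)) (dvec m d δ i)
            /ℚ πv m (dvec m d δ i))
      ≡ 0ℚ
mainTheorem2 zero () d δ d≥1 δ≥1 _ δd≢δd s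
mainTheorem2 (suc m′) _ d δ d≥1 δ≥1 _ δd≢δd s =
  Decomposition.decomposition s (ℕtoℚ ∘ d) (ℕtoℚ ∘ δ) (dvec (suc m′) d δ)
    (ℕtoℚ-≢0 ∘ d≥1) (ℕtoℚ-≢0 ∘ δ≥1) δd≢δd-in-ℚ (dvec-diag (suc m′) d δ) (dvec-off (suc m′) d δ)
  where
  δd≢δd-in-ℚ : ∀ i j → i ≢ j → ℕtoℚ (δ i) * ℕtoℚ (d j) ≢ ℕtoℚ (δ j) * ℕtoℚ (d i)
  δd≢δd-in-ℚ i j i≢j eq =
    δd≢δd i j i≢j (ℕtoℚ-injective (trans (ℕtoℚ-* (δ i) (d j)) (trans eq (sym (ℕtoℚ-* (δ j) (d i))))))
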